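{- Let $\tau^0,\tau^1$ be generalized patterns with no hyphens, let $\tau=\tau^0\mbox{ - }\tau^1$ be the multi-pattern formed from them, and let $\phi=f_1(\tau^0)\mbox{ - }f_2(\tau^1)$, where $f_1$ and $f_2$ are any trivial bijections. Then $\tau\equiv\phi$.
   Context: $[k]^n$ = words of length $n$ over $\{1,\dots,k\}$. A generalized pattern with no hyphens is a word over $[m]$ using every letter of $[m]$. A multi-pattern $\tau^0\mbox{ - }\tau^1\mbox{ - }\cdots\mbox{ - }\tau^s$ (each $\tau^i$ a generalized pattern with no hyphens) is the pattern obtained by concatenating the $\tau^i$ with hyphens between consecutive blocks, where letters within a block are ordered as usual and every letter of $\tau^i$ is incomparable with every letter of $\tau^j$ for $i\ne j$. A word $\sigma$ contains it if $\sigma$ has occurrences (as factors of consecutive letters, order-isomorphic to the block, with equalities preserved) of $\tau^0,\tau^1,\dots,\tau^s$ in this left-to-right order, pairwise non-overlapping; otherwise $\sigma$ avoids it. Two patterns are equivalent ($\equiv$) if for every $k$ and $n$ the numbers of words in $[k]^n$ avoiding them are equal. Trivial bijections are the reverse $R(\sigma_1\cdots\sigma_n)=\sigma_n\cdots\sigma_1$, the complement $C$ (replacing each letter $a$ by $M+1-a$, $M$ the largest letter of the alphabet / of the pattern), and $R\circ C$. -}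

module Defs where

open import Data.Bool using (Bool; true; false; _∧_; _∨_; not)
open import Data.Bool.Properties using () renaming (_≟_ to _≟ᵇ_)
open import Data.Nat using (ℕ; zero; suc; _≤_; _∸_; _⊔_; _<ᵇ_)
open import Data.List using (List; []; _∷_; length; map; concatMap; upTo; take; drop; reverse; filterᵇ; foldr)
open import Data.List.Relation.Unary.All using (All)
open import Data.List.Membership.Propositional using (_∈_)
open import Data.Product using (_×_)
open import Relation.Binary.PropositionalEquality using (_≡_)
open import Relation.Nullary.Decidable using (⌊_⌋)

-- Words are lists of natural numbers; letters of [k] are 1,…,k.

allWords : ℕ → ℕ → List (List ℕ)
allWords k zero    = [] ∷ []
allWords k (suc n) = concatMap (λ a → map (a ∷_) (allWords k n)) (map suc (upTo k))

-- A generalized pattern with no hyphens over [m]: a word over [m]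
-- using every letter of [m].
IsPattern : ℕ → List ℕ → Set
IsPattern m p = All (λ a → 1 ≤ a × a ≤ m) p × (∀ a → 1 ≤ a → a ≤ m → a ∈ p)

_==_ : Bool → Bool → Bool
b == c = ⌊ b ≟ᵇ c ⌋

sameRel : ℕ → ℕ → ℕ → ℕ → Bool
sameRel a x b y = ((a <ᵇ x) == (b <ᵇ y)) ∧ ((x <ᵇ a) == (y <ᵇ b))

headRel : ℕ → List ℕ → ℕ → List ℕ → Bool
headRel a [] b [] = true
headRel a (x ∷ u) b (y ∷ v) = sameRel a x b y ∧ headRel a u b v
headRel a _ b _ = false

orderIso : List ℕ → List ℕ → Bool
orderIso [] [] = true
orderIso (a ∷ u) (b ∷ v) = headRel a u b v ∧ orderIso u v
orderIso _ _ = false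

-- A multi-pattern τ^0-τ^1-…-τ^s is given as the list of its blocks.
-- containsM ps w: w has pairwise non-overlapping occurrences (as factors)
-- of the blocks of ps, in left-to-right order.
containsM : List (List ℕ) → List ℕ → Bool
containsM [] w = true
containsM (p ∷ ps) [] = orderIso p [] ∧ containsM ps []
containsM (p ∷ ps) (x ∷ w) =
  (orderIso p (take (length p) (x ∷ w)) ∧ containsM ps (drop (length p) (x ∷ w)))
  ∨ containsM (p ∷ ps) w

avoids : List (List ℕ) → List ℕ → Bool
avoids ps w = not (containsM ps w)

avoidCount : ℕ → ℕ → List (List ℕ) → ℕ
avoidCount k n ps = length (filterᵇ (avoids ps) (allWords k n))

_≡ₚ_ : List (List ℕ) → List (List ℕ) → Set
ps ≡ₚ qs = ∀ k n → avoidCount k n ps ≡ avoidCount k n qs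

maxLetter : List ℕ → ℕ
maxLetter = foldr _⊔_ 0

complement : List ℕ → List ℕ
complement p = map (λ a → suc (maxLetter p) ∸ a) p

data TrivialBijection : Set where
  R C RC : TrivialBijection

applyTB : TrivialBijection → List ℕ → List ℕ
applyTB R  p = reverse p
applyTB C  p = complement p
applyTB RC p = reverse (complement p)

{-# OPTIONS --safe #-}
module Submission where

-- Write a(π; n) for the number of words of [k]^n avoiding π. A word avoids τ⁰-τ¹-…-τˢ iff it
-- avoids τ⁰, or the suffix following its shortest prefix containing τ⁰ avoids τ¹-…-τˢ. Sorting
-- the words by the length j of that prefix gives
--   a(τ⁰-τ¹-…-τˢ; n) = a(τ⁰; n) + Σ_{j ≤ n} m(τ⁰; j) · a(τ¹-…-τˢ; n − j),
-- where m(p; j) counts the words of length j that contain p while their proper prefixes do not.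
-- Since m(p; 0) + a(p; 0) = 1 and m(p; j + 1) + a(p; j + 1) = k · a(p; j), the numbers m(p; ·)
-- are determined by a(p; ·). Hence the avoidance counts of a multi-pattern depend only on those
-- of its blocks, and reverse and complement preserve the avoidance counts of a single block
-- because they act bijectively on [k]^n and carry occurrences to occurrences.

open import Defs
open import Data.Nat using (ℕ)
open import Data.List using (List; []; _∷_)

open import Data.Bool using (Bool; true; false; _∧_; _∨_; not; T)
open import Data.Bool.Properties
  using (∧-conicalˡ; ∧-conicalʳ; ∧-comm; ∧-assoc; ∧-identityʳ; ∧-zeroʳ; ∨-zeroʳ; ∧-commutativeMonoid; ⇔→≡)
open import Data.Fin using (Fin; toℕ; opposite)
open import Data.Fin.Properties using (toℕ-inject₁; toℕ-fromℕ; toℕ<n; opposite-prop)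
import Data.Fin.Permutation as Perm
open import Data.List using (length; map; take; drop; reverse; _++_; _∷ʳ_; filterᵇ; concatMap; applyUpTo)
open import Data.List.Properties
  using (++-assoc; ++-identityʳ; length-++; length-map; take++drop≡id; take-take; take-all; take-map;
         drop-drop; unfold-reverse; reverse-++; reverse-involutive; filter-++)
open import Data.List.Relation.Binary.Pointwise using (Pointwise; []; _∷_)
open import Data.List.Relation.Unary.All as All using (All; []; _∷_; tabulate)
open import Data.List.Relation.Unary.All.Properties using (take⁺)
open import Data.Nat using (suc; zero; _+_; _*_; _∸_; _≤_; _<_; _<ᵇ_; z≤n; _≤′_; ≤′-refl; ≤′-step)
open import Data.Nat.Properties
  using (+-suc; +-identityʳ; +-assoc; +-comm; +-cancelʳ-≡; +-∸-assoc; m+[n∸m]≡n; ≤-refl; ≤-reflexive;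
         ≤-trans; ≤-pred; n≤1+n; m≤n⇒m≤1+n; ≤⇒≤′; _≤?_; ≰⇒>; <⇒≱; m≤m⊔n; m≤n⊔m; m≤n⇒m⊓n≡m;
         ∸-monoʳ-<; ∸-monoʳ-≤; <ᵇ-reflects-<; <ᵇ⇒<; <⇒<ᵇ; +-*-semiring)
open import Algebra.Properties.Semiring.Sum +-*-semiring
  using (sum-syntax; sum-cong-≗; ∑-comm; *-distribʳ-sum; sum-init-last; sum-permute)
open import Data.Product using (∃-syntax; _×_; _,_)
open import Data.Sum using (_⊎_; inj₁; inj₂)
open import Function using (_∘_; id; mk⇔; case_of_)
open import Relation.Binary.PropositionalEquality
  using (_≡_; refl; sym; trans; cong; cong₂; subst; subst₂; module ≡-Reasoning)
open import Relation.Nullary using (yes; no)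
open import Relation.Nullary.Decidable using (T?)
open import Relation.Nullary.Reflects using (det; fromEquivalence)

∨-true⁻ : ∀ a {b} → a ∨ b ≡ true → a ≡ true ⊎ b ≡ true
∨-true⁻ true  _ = inj₁ refl
∨-true⁻ false e = inj₂ e

∨-trueʳ : ∀ a {b} → b ≡ true → a ∨ b ≡ true
∨-trueʳ a refl = ∨-zeroʳ a

not-∧-absorb : ∀ {c d} → (c ≡ true → d ≡ true) → not c ∧ not d ≡ not d
not-∧-absorb {true}  {true}  _   = refl
not-∧-absorb {true}  {false} c⇒d = case c⇒d refl of λ ()
not-∧-absorb {false} {d}     _   = refl

take-length-++ : ∀ {A : Set} (xs ys : List A) → take (length xs) (xs ++ ys) ≡ xs
take-length-++ []       ys = refl
take-length-++ (x ∷ xs) ys = cong (x ∷_) (take-length-++ xs ys)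

drop-length-++ : ∀ {A : Set} (xs ys : List A) → drop (length xs) (xs ++ ys) ≡ ys
drop-length-++ []       ys = refl
drop-length-++ (x ∷ xs) ys = drop-length-++ xs ys

take-take-≤ : ∀ {A : Set} {i j} (xs : List A) → i ≤ j → take i (take j xs) ≡ take i xs
take-take-≤ {i = i} {j} xs i≤j = trans (take-take i j xs) (cong (λ m → take m xs) (m≤n⇒m⊓n≡m i≤j))

occurs : List ℕ → List ℕ → Bool
occurs p = containsM (p ∷ [])

Contains : List (List ℕ) → List ℕ → Set
Contains ps w = containsM ps w ≡ true

data Occurrence (p : List ℕ) (R : List ℕ → Set) : List ℕ → Set where
  occurrence : ∀ u {y} r → orderIso p y ≡ true → R r → Occurrence p R (u ++ y ++ r)

orderIso⇒length : ∀ p y → orderIso p y ≡ true → length p ≡ length y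
orderIso⇒length []      []      _ = refl
orderIso⇒length (a ∷ p) (b ∷ y) e = cong suc (orderIso⇒length p y (∧-conicalʳ _ _ e))

orderIso-[] : ∀ p → orderIso p [] ≡ true → p ≡ []
orderIso-[] [] _ = refl

containsM-∷ : ∀ ps x {w} → Contains ps w → Contains ps (x ∷ w)
containsM-∷ []       x h = refl
containsM-∷ (p ∷ ps) x h = ∨-trueʳ _ h

containsM-++ˡ : ∀ ps u {v} → Contains ps v → Contains ps (u ++ v)
containsM-++ˡ ps []      h = h
containsM-++ˡ ps (x ∷ u) h = containsM-∷ ps x (containsM-++ˡ ps u h)

containsM-drop : ∀ ps {i j} w → i ≤ j → Contains ps (drop j w) → Contains ps (drop i w)
containsM-drop ps {i} {j} w i≤j h =
  subst (Contains ps) (take++drop≡id (j ∸ i) (drop i w))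
    (containsM-++ˡ ps (take (j ∸ i) (drop i w)) (subst (Contains ps) (sym dropTwice) h))
  where
  dropTwice : drop (j ∸ i) (drop i w) ≡ drop j w
  dropTwice = trans (drop-drop i (j ∸ i) w) (cong (λ m → drop m w) (m+[n∸m]≡n i≤j))

containsM-here : ∀ p ps {y} r → orderIso p y ≡ true → Contains ps r → Contains (p ∷ ps) (y ++ r)
containsM-here p ps {[]}    []      oi h = cong₂ _∧_ oi h
containsM-here p ps {[]}    (x ∷ r) oi h with orderIso-[] p oi
... | refl = cong (_∨ _) h
containsM-here p ps {x ∷ y} r       oi h
  rewrite orderIso⇒length p (x ∷ y) oi | take-length-++ y r | drop-length-++ y r
  = cong (_∨ _) (cong₂ _∧_ oi h)

Occurrence⇒containsM : ∀ p ps {w} → Occurrence p (Contains ps) w → Contains (p ∷ ps) w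
Occurrence⇒containsM p ps (occurrence u r oi h) = containsM-++ˡ (p ∷ ps) u (containsM-here p ps r oi h)

containsM⇒Occurrence : ∀ p ps w → Contains (p ∷ ps) w → Occurrence p (Contains ps) w
containsM⇒Occurrence p ps []      h = occurrence [] [] (∧-conicalˡ _ _ h) (∧-conicalʳ _ _ h)
containsM⇒Occurrence p ps (x ∷ w) h with ∨-true⁻ _ h
... | inj₁ here  = subst (Occurrence p (Contains ps)) (take++drop≡id (length p) (x ∷ w))
                     (occurrence [] _ (∧-conicalˡ _ _ here) (∧-conicalʳ _ _ here))
... | inj₂ there with containsM⇒Occurrence p ps w there
...   | occurrence u r oi h = occurrence (x ∷ u) r oi h

occurs-factor : ∀ p u {y} v → orderIso p y ≡ true → occurs p (u ++ y ++ v) ≡ true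
occurs-factor p u v oi = Occurrence⇒containsM p [] (occurrence u v oi refl)

containsM⇒occurs : ∀ p ps w → Contains (p ∷ ps) w → occurs p w ≡ true
containsM⇒occurs p ps w h with containsM⇒Occurrence p ps w h
... | occurrence u r oi _ = occurs-factor p u r oi

containsM-++ : ∀ p ps u {v} → occurs p u ≡ true → Contains ps v → Contains (p ∷ ps) (u ++ v)
containsM-++ p ps u {v} o h with containsM⇒Occurrence p [] u o
... | occurrence a {y} r oi _ =
  subst (Contains (p ∷ ps)) (sym reassociate)
    (Occurrence⇒containsM p ps (occurrence a (r ++ v) oi (containsM-++ˡ ps r h)))
  where
  reassociate : (a ++ y ++ r) ++ v ≡ a ++ y ++ r ++ v
  reassociate = trans (++-assoc a (y ++ r) v) (cong (a ++_) (++-assoc y r v))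

occurs-++ʳ : ∀ p u v → occurs p u ≡ true → occurs p (u ++ v) ≡ true
occurs-++ʳ p u v o = containsM-++ p [] u o refl

containsM-∷⁻ : ∀ p ps w → Contains (p ∷ ps) w → ∃[ a ] occurs p (take a w) ≡ true × Contains ps (drop a w)
containsM-∷⁻ p ps w h with containsM⇒Occurrence p ps w h
... | occurrence u {y} r oi rest rewrite sym (++-assoc u y r) = length (u ++ y) , prefix , suffix
  where
  prefix : occurs p (take (length (u ++ y)) ((u ++ y) ++ r)) ≡ true
  prefix rewrite take-length-++ (u ++ y) r =
    subst (λ v → occurs p (u ++ v) ≡ true) (++-identityʳ y) (occurs-factor p u [] oi)
  suffix : Contains ps (drop (length (u ++ y)) ((u ++ y) ++ r))
  suffix rewrite drop-length-++ (u ++ y) r = rest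

-- Reverse and complement

sameRel-sym : ∀ a x b y → sameRel a x b y ≡ sameRel x a y b
sameRel-sym a x b y = ∧-comm ((a <ᵇ x) == (b <ᵇ y)) _

headRel-[]-∷ʳ : ∀ a b v y → headRel a [] b (v ∷ʳ y) ≡ false
headRel-[]-∷ʳ a b []      y = refl
headRel-[]-∷ʳ a b (_ ∷ _) y = refl

headRel-∷ʳ-[] : ∀ a b u x → headRel a (u ∷ʳ x) b [] ≡ false
headRel-∷ʳ-[] a b []      x = refl
headRel-∷ʳ-[] a b (_ ∷ _) x = refl

orderIso-[]-∷ʳ : ∀ v y → orderIso [] (v ∷ʳ y) ≡ false
orderIso-[]-∷ʳ []      y = refl
orderIso-[]-∷ʳ (_ ∷ _) y = refl

orderIso-∷ʳ-[] : ∀ u x → orderIso (u ∷ʳ x) [] ≡ false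
orderIso-∷ʳ-[] []      x = refl
orderIso-∷ʳ-[] (_ ∷ _) x = refl

headRel-∷ʳ : ∀ a u b v x y → headRel a (u ∷ʳ x) b (v ∷ʳ y) ≡ headRel a u b v ∧ sameRel a x b y
headRel-∷ʳ a []       b []       x y = ∧-identityʳ _
headRel-∷ʳ a []       b (y′ ∷ v) x y rewrite headRel-[]-∷ʳ a b v y = ∧-zeroʳ _
headRel-∷ʳ a (x′ ∷ u) b []       x y rewrite headRel-∷ʳ-[] a b u x = ∧-zeroʳ _
headRel-∷ʳ a (x′ ∷ u) b (y′ ∷ v) x y rewrite headRel-∷ʳ a u b v x y = sym (∧-assoc (sameRel a x′ b y′) _ _)

orderIso-∷ʳ : ∀ u v a b → orderIso (u ∷ʳ a) (v ∷ʳ b) ≡ headRel a u b v ∧ orderIso u v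
orderIso-∷ʳ []      []      a b = refl
orderIso-∷ʳ []      (y ∷ v) a b rewrite headRel-[]-∷ʳ a y v b = refl
orderIso-∷ʳ (x ∷ u) []      a b rewrite headRel-∷ʳ-[] x b u a = refl
orderIso-∷ʳ (x ∷ u) (y ∷ v) a b
  rewrite headRel-∷ʳ x u y v a b | orderIso-∷ʳ u v a b | sameRel-sym x a y b
  = solve 4 (λ h s h′ o → (h ⊕ s) ⊕ (h′ ⊕ o) ⊜ (s ⊕ h′) ⊕ (h ⊕ o)) refl
      (headRel x u y v) (sameRel a x b y) (headRel a u b v) (orderIso u v)
  where open import Algebra.Solver.CommutativeMonoid ∧-commutativeMonoid using (solve; _⊕_; _⊜_)

headRel-reverse : ∀ a u b v → headRel a (reverse u) b (reverse v) ≡ headRel a u b v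
headRel-reverse a []      b []      = refl
headRel-reverse a []      b (y ∷ v) rewrite unfold-reverse y v = headRel-[]-∷ʳ a b (reverse v) y
headRel-reverse a (x ∷ u) b []      rewrite unfold-reverse x u = headRel-∷ʳ-[] a b (reverse u) x
headRel-reverse a (x ∷ u) b (y ∷ v)
  rewrite unfold-reverse x u | unfold-reverse y v
        | headRel-∷ʳ a (reverse u) b (reverse v) x y | headRel-reverse a u b v
  = ∧-comm (headRel a u b v) (sameRel a x b y)

orderIso-reverse : ∀ p y → orderIso (reverse p) (reverse y) ≡ orderIso p y
orderIso-reverse []      []      = refl
orderIso-reverse []      (b ∷ y) rewrite unfold-reverse b y = orderIso-[]-∷ʳ (reverse y) b
orderIso-reverse (a ∷ p) []      rewrite unfold-reverse a p = orderIso-∷ʳ-[] (reverse p) a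
orderIso-reverse (a ∷ p) (b ∷ y)
  rewrite unfold-reverse a p | unfold-reverse b y
        | orderIso-∷ʳ (reverse p) (reverse y) a b | headRel-reverse a p b y | orderIso-reverse p y
  = refl

occurs-reverse : ∀ p w → occurs p w ≡ true → occurs (reverse p) (reverse w) ≡ true
occurs-reverse p w h with containsM⇒Occurrence p [] w h
... | occurrence u {y} r oi _ =
  subst (λ v → occurs (reverse p) v ≡ true) (sym reverse-factor)
    (occurs-factor (reverse p) (reverse r) (reverse u) (trans (orderIso-reverse p y) oi))
  where
  open ≡-Reasoning
  reverse-factor : reverse (u ++ y ++ r) ≡ reverse r ++ reverse y ++ reverse u
  reverse-factor = begin
    reverse (u ++ y ++ r)                  ≡⟨ reverse-++ u (y ++ r) ⟩
    reverse (y ++ r) ++ reverse u          ≡⟨ cong (_++ reverse u) (reverse-++ y r) ⟩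
    (reverse r ++ reverse y) ++ reverse u  ≡⟨ ++-assoc (reverse r) (reverse y) (reverse u) ⟩
    reverse r ++ reverse y ++ reverse u    ∎

occurs-reverse-≡ : ∀ p w → occurs (reverse p) (reverse w) ≡ occurs p w
occurs-reverse-≡ p w = ⇔→≡ (mk⇔ from (occurs-reverse p w))
  where
  from : occurs (reverse p) (reverse w) ≡ true → occurs p w ≡ true
  from h = subst₂ (λ p′ w′ → occurs p′ w′ ≡ true) (reverse-involutive p) (reverse-involutive w)
             (occurs-reverse (reverse p) (reverse w) h)

<ᵇ-complement : ∀ M {a} x → a ≤ M → (suc M ∸ a <ᵇ suc M ∸ x) ≡ (x <ᵇ a)
<ᵇ-complement M {a} x a≤M = det (<ᵇ-reflects-< _ _) (fromEquivalence to from)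
  where
  to : T (x <ᵇ a) → suc M ∸ a < suc M ∸ x
  to x<a = ∸-monoʳ-< (<ᵇ⇒< x a x<a) (m≤n⇒m≤1+n a≤M)
  from : suc M ∸ a < suc M ∸ x → T (x <ᵇ a)
  from lt = <⇒<ᵇ {x} {a} (≰⇒> (λ a≤x → <⇒≱ lt (∸-monoʳ-≤ (suc M) a≤x)))

-- orderIso only compares letters, so the pattern and the word may be complemented with respect
-- to different bounds.
module _ (M K : ℕ) where

  sameRel-complement : ∀ {a x b y} → a ≤ M → x ≤ M → b ≤ K → y ≤ K →
    sameRel (suc M ∸ a) (suc M ∸ x) (suc K ∸ b) (suc K ∸ y) ≡ sameRel a x b y
  sameRel-complement {a} {x} {b} {y} a≤M x≤M b≤K y≤K =
    trans (cong₂ _∧_ (cong₂ _==_ (<ᵇ-complement M x a≤M) (<ᵇ-complement K y b≤K))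
                     (cong₂ _==_ (<ᵇ-complement M a x≤M) (<ᵇ-complement K b y≤K)))
          (sameRel-sym x a y b)

  headRel-complement : ∀ {a b} u v → a ≤ M → All (_≤ M) u → b ≤ K → All (_≤ K) v →
    headRel (suc M ∸ a) (map (suc M ∸_) u) (suc K ∸ b) (map (suc K ∸_) v) ≡ headRel a u b v
  headRel-complement []      []      _   _           _   _           = refl
  headRel-complement []      (_ ∷ _) _   _           _   _           = refl
  headRel-complement (_ ∷ _) []      _   _           _   _           = refl
  headRel-complement (x ∷ u) (y ∷ v) a≤M (x≤M ∷ u≤M) b≤K (y≤K ∷ v≤K) =
    cong₂ _∧_ (sameRel-complement a≤M x≤M b≤K y≤K) (headRel-complement u v a≤M u≤M b≤K v≤K)

  orderIso-complement : ∀ p y → All (_≤ M) p → All (_≤ K) y →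
    orderIso (map (suc M ∸_) p) (map (suc K ∸_) y) ≡ orderIso p y
  orderIso-complement []      []      _           _           = refl
  orderIso-complement []      (_ ∷ _) _           _           = refl
  orderIso-complement (_ ∷ _) []      _           _           = refl
  orderIso-complement (a ∷ p) (b ∷ y) (a≤M ∷ p≤M) (b≤K ∷ y≤K) =
    cong₂ _∧_ (headRel-complement p y a≤M p≤M b≤K y≤K) (orderIso-complement p y p≤M y≤K)

  occurs-complement : ∀ p w → All (_≤ M) p → All (_≤ K) w →
    occurs (map (suc M ∸_) p) (map (suc K ∸_) w) ≡ occurs p w
  occurs-complement p []      p≤M []          = cong (_∧ true) (orderIso-complement p [] p≤M [])
  occurs-complement p (x ∷ w) p≤M (x≤K ∷ w≤K) =
    cong₂ _∨_ (cong (_∧ true) atStart) (occurs-complement p w p≤M w≤K)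
    where
    atStart : orderIso (map (suc M ∸_) p) (take (length (map (suc M ∸_) p)) (map (suc K ∸_) (x ∷ w)))
            ≡ orderIso p (take (length p) (x ∷ w))
    atStart rewrite length-map (suc M ∸_) p | take-map {f = suc K ∸_} (length p) (x ∷ w) =
      orderIso-complement p (take (length p) (x ∷ w)) p≤M (take⁺ (length p) (x≤K ∷ w≤K))

All-≤-maxLetter : ∀ p → All (_≤ maxLetter p) p
All-≤-maxLetter []      = []
All-≤-maxLetter (a ∷ p) =
  m≤m⊔n a (maxLetter p) ∷ All.map (λ b≤ → ≤-trans b≤ (m≤n⊔m a (maxLetter p))) (All-≤-maxLetter p)

Increasing : (ℕ → Bool) → Set
Increasing b = ∀ j → b j ≡ true → b (suc j) ≡ true

becomesTrueAt : (ℕ → Bool) → ℕ → Bool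
becomesTrueAt b zero    = b zero
becomesTrueAt b (suc j) = b (suc j) ∧ not (b j)

Increasing-≤ : ∀ {b i j} → Increasing b → i ≤ j → b i ≡ true → b j ≡ true
Increasing-≤ {b} b↑ i≤j = go (≤⇒≤′ i≤j)
  where
  go : ∀ {i j} → i ≤′ j → b i ≡ true → b j ≡ true
  go ≤′-refl       h = h
  go (≤′-step i≤j) h = b↑ _ (go i≤j h)

becomesTrueAt⇒true : ∀ b j → becomesTrueAt b j ≡ true → b j ≡ true
becomesTrueAt⇒true b zero    h = h
becomesTrueAt⇒true b (suc j) h = ∧-conicalˡ _ _ h

becomesTrueAt-minimal : ∀ {b} j → Increasing b → becomesTrueAt b j ≡ true → ∀ i → b i ≡ true → j ≤ i
becomesTrueAt-minimal zero        _  _ _ _  = z≤n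
becomesTrueAt-minimal {b} (suc j) b↑ h i bi with suc j ≤? i
... | yes j<i = j<i
... | no  j≮i = case trans (cong not (sym bj)) (∧-conicalʳ (b (suc j)) _ h) of λ ()
  where
  bj : b j ≡ true
  bj = Increasing-≤ b↑ (≤-pred (≰⇒> j≮i)) bi

becomesTrueAt-cong : ∀ {b b′} j → (∀ i → i ≤ j → b i ≡ b′ i) → becomesTrueAt b j ≡ becomesTrueAt b′ j
becomesTrueAt-cong zero    b≗b′ = b≗b′ 0 z≤n
becomesTrueAt-cong (suc j) b≗b′ = cong₂ (λ x y → x ∧ not y) (b≗b′ (suc j) ≤-refl) (b≗b′ j (n≤1+n j))

count : {A : Set} → (A → Bool) → List A → ℕ
count P xs = length (filterᵇ P xs)

count-congᴬ : ∀ {A : Set} {P Q : A → Bool} {xs} → All (λ x → P x ≡ Q x) xs → count P xs ≡ count Q xs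
count-congᴬ             {xs = []}     []           = refl
count-congᴬ {P = P} {Q} {xs = x ∷ xs} (Px≡Qx ∷ eq) with P x | Q x | count-congᴬ eq
... | true  | true  | ih = cong suc ih
... | false | false | ih = ih

count-cong : ∀ {A : Set} {P Q : A → Bool} → (∀ x → P x ≡ Q x) → ∀ xs → count P xs ≡ count Q xs
count-cong P≗Q xs = count-congᴬ {xs = xs} (tabulate (λ {x} _ → P≗Q x))

count-++ : ∀ {A : Set} (P : A → Bool) xs ys → count P (xs ++ ys) ≡ count P xs + count P ys
count-++ P xs ys = trans (cong length (filter-++ (T? ∘ P) xs ys)) (length-++ (filterᵇ P xs))

count-map : ∀ {A B : Set} (P : A → Bool) (f : B → A) xs → count P (map f xs) ≡ count (P ∘ f) xs
count-map P f []       = refl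
count-map P f (x ∷ xs) with P (f x)
... | true  = cong suc (count-map P f xs)
... | false = count-map P f xs

count-false : ∀ {A : Set} (xs : List A) → count (λ _ → false) xs ≡ 0
count-false []       = refl
count-false (_ ∷ xs) = count-false xs

count-split : ∀ {A : Set} (P Q : A → Bool) xs →
  count P xs ≡ count (λ x → P x ∧ Q x) xs + count (λ x → P x ∧ not (Q x)) xs
count-split P Q []       = refl
count-split P Q (x ∷ xs) with P x | Q x
... | true  | true  = cong suc (count-split P Q xs)
... | true  | false = trans (cong suc (count-split P Q xs)) (sym (+-suc _ _))
... | false | _     = count-split P Q xs

∑-const : ∀ n c → ∑[ i < n ] c ≡ n * c
∑-const zero    c = refl
∑-const (suc n) c = cong (c +_) (∑-const n c)

∑-snoc : ∀ n (f : ℕ → ℕ) → ∑[ j < suc n ] f (toℕ j) ≡ ∑[ j < n ] f (toℕ j) + f n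
∑-snoc n f = trans (sum-init-last {n} (f ∘ toℕ))
                   (cong₂ _+_ (sum-cong-≗ {n} (λ j → cong f (toℕ-inject₁ j))) (cong f (toℕ-fromℕ n)))

count-partition : ∀ {A : Set} (b : A → ℕ → Bool) → (∀ x → Increasing (b x)) → ∀ (P : A → Bool) m xs →
  count P xs ≡ ∑[ j < suc m ] count (λ x → P x ∧ becomesTrueAt (b x) (toℕ j)) xs
               + count (λ x → P x ∧ not (b x m)) xs
count-partition b b↑ P zero    xs =
  trans (count-split P (λ x → b x 0) xs)
        (cong (_+ count (λ x → P x ∧ not (b x 0)) xs) (sym (+-identityʳ (count (λ x → P x ∧ b x 0) xs))))
count-partition b b↑ P (suc m) xs = begin
  count P xs
    ≡⟨ count-partition b b↑ P m xs ⟩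
  ∑[ j < suc m ] firstAt (toℕ j) + notYet m
    ≡⟨ cong (∑[ j < suc m ] firstAt (toℕ j) +_) step ⟩
  ∑[ j < suc m ] firstAt (toℕ j) + (firstAt (suc m) + notYet (suc m))
    ≡⟨ +-assoc (∑[ j < suc m ] firstAt (toℕ j)) _ _ ⟨
  (∑[ j < suc m ] firstAt (toℕ j) + firstAt (suc m)) + notYet (suc m)
    ≡⟨ cong (_+ notYet (suc m)) (∑-snoc (suc m) firstAt) ⟨
  ∑[ j < suc (suc m) ] firstAt (toℕ j) + notYet (suc m)
    ∎
  where
  open ≡-Reasoning
  firstAt notYet : ℕ → ℕ
  firstAt j = count (λ x → P x ∧ becomesTrueAt (b x) j) xs
  notYet  j = count (λ x → P x ∧ not (b x j)) xs
  step : notYet m ≡ firstAt (suc m) + notYet (suc m)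
  step = trans (count-split _ (λ x → b x (suc m)) xs) (cong₂ _+_ (count-cong reorder xs) (count-cong absorb xs))
    where
    reorder : ∀ x → (P x ∧ not (b x m)) ∧ b x (suc m) ≡ P x ∧ becomesTrueAt (b x) (suc m)
    reorder x = trans (∧-assoc (P x) _ _) (cong (P x ∧_) (∧-comm (not (b x m)) _))
    absorb : ∀ x → (P x ∧ not (b x m)) ∧ not (b x (suc m)) ≡ P x ∧ not (b x (suc m))
    absorb x = trans (∧-assoc (P x) _ _) (cong (P x ∧_) (not-∧-absorb (b↑ x m)))

count-prefixed : ∀ (P : List ℕ → Bool) (g : ℕ → ℕ) m W →
  count P (concatMap (λ a → map (a ∷_) W) (map suc (applyUpTo g m)))
    ≡ ∑[ i < m ] count (λ w → P (suc (g (toℕ i)) ∷ w)) W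
count-prefixed P g zero    W = refl
count-prefixed P g (suc m) W =
  trans (count-++ P (map (suc (g 0) ∷_) W) _) (cong₂ _+_ (count-map P _ W) (count-prefixed P (g ∘ suc) m W))

-- The first occurrence of the first block

occursInPrefix : List ℕ → List ℕ → ℕ → Bool
occursInPrefix p w j = occurs p (take j w)

occursInPrefix-increasing : ∀ p w → Increasing (occursInPrefix p w)
occursInPrefix-increasing p w j o =
  subst (λ v → occurs p v ≡ true) (take++drop≡id j (take (suc j) w))
    (occurs-++ʳ p (take j (take (suc j) w)) (drop j (take (suc j) w))
      (subst (λ v → occurs p v ≡ true) (sym (take-take-≤ w (n≤1+n j))) o))

becomesTrueAt-take : ∀ p w j →
  becomesTrueAt (occursInPrefix p (take j w)) j ≡ becomesTrueAt (occursInPrefix p w) j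
becomesTrueAt-take p w j = becomesTrueAt-cong j (λ i i≤j → cong (occurs p) (take-take-≤ w i≤j))

containsM-becomesTrueAt : ∀ p ps w j → becomesTrueAt (occursInPrefix p w) j ≡ true →
  containsM (p ∷ ps) w ≡ containsM ps (drop j w)
containsM-becomesTrueAt p ps w j first = ⇔→≡ (mk⇔ to from)
  where
  to : Contains (p ∷ ps) w → Contains ps (drop j w)
  to c with containsM-∷⁻ p ps w c
  ... | a , inPrefix , rest =
    containsM-drop ps w (becomesTrueAt-minimal j (occursInPrefix-increasing p w) first a inPrefix) rest
  from : Contains ps (drop j w) → Contains (p ∷ ps) w
  from c = subst (Contains (p ∷ ps)) (take++drop≡id j w)
             (containsM-++ p ps (take j w) (becomesTrueAt⇒true (occursInPrefix p w) j first) c)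

-- Words over [k]

module Words (k : ℕ) where

  letter : Fin k → ℕ
  letter i = suc (toℕ i)

  countWords : ℕ → (List ℕ → Bool) → ℕ
  countWords n P = count P (allWords k n)

  countWords-suc : ∀ n P → countWords (suc n) P ≡ ∑[ i < k ] countWords n (λ w → P (letter i ∷ w))
  countWords-suc n P = count-prefixed P id k (allWords k n)

  countWords-congᵂ : ∀ n {P Q} → (∀ w → length w ≡ n → All (_≤ k) w → P w ≡ Q w) →
    countWords n P ≡ countWords n Q
  countWords-congᵂ zero    {P} {Q} h = count-congᴬ {P = P} {Q} (h [] refl [] ∷ [])
  countWords-congᵂ (suc n) {P} {Q} h = begin
    countWords (suc n) P                             ≡⟨ countWords-suc n P ⟩
    ∑[ i < k ] countWords n (λ w → P (letter i ∷ w))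
      ≡⟨ sum-cong-≗ {k} (λ i → countWords-congᵂ n (λ w |w| w≤k → h (letter i ∷ w) (cong suc |w|) (toℕ<n i ∷ w≤k))) ⟩
    ∑[ i < k ] countWords n (λ w → Q (letter i ∷ w)) ≡⟨ countWords-suc n Q ⟨
    countWords (suc n) Q                             ∎
    where open ≡-Reasoning

  countWords-snoc : ∀ n P → countWords (suc n) P ≡ ∑[ i < k ] countWords n (λ w → P (w ∷ʳ letter i))
  countWords-snoc zero    P = trans (countWords-suc 0 P) (sum-cong-≗ {k} (λ i →
    count-congᴬ {P = λ w → P (letter i ∷ w)} {Q = λ w → P (w ∷ʳ letter i)} (refl ∷ [])))
  countWords-snoc (suc n) P = begin
    countWords (suc (suc n)) P                                               ≡⟨ countWords-suc (suc n) P ⟩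
    ∑[ i < k ] countWords (suc n) (λ w → P (letter i ∷ w))
      ≡⟨ sum-cong-≗ {k} (λ i → countWords-snoc n (λ w → P (letter i ∷ w))) ⟩
    ∑[ i < k ] ∑[ j < k ] countWords n (λ w → P (letter i ∷ w ∷ʳ letter j)) ≡⟨ ∑-comm {k} {k} _ ⟩
    ∑[ j < k ] ∑[ i < k ] countWords n (λ w → P (letter i ∷ w ∷ʳ letter j))
      ≡⟨ sum-cong-≗ {k} (λ j → countWords-suc n (λ w → P (w ∷ʳ letter j))) ⟨
    ∑[ j < k ] countWords (suc n) (λ w → P (w ∷ʳ letter j))                  ∎
    where open ≡-Reasoning

  countWords-take : ∀ n P → countWords (suc n) (λ w → P (take n w)) ≡ k * countWords n P
  countWords-take n P = begin
    countWords (suc n) (λ w → P (take n w))                    ≡⟨ countWords-snoc n _ ⟩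
    ∑[ i < k ] countWords n (λ w → P (take n (w ∷ʳ letter i)))
      ≡⟨ sum-cong-≗ {k} (λ i → countWords-congᵂ n (λ w |w| _ → cong P (take-∷ʳ w (letter i) |w|))) ⟩
    ∑[ i < k ] countWords n P                                  ≡⟨ ∑-const k _ ⟩
    k * countWords n P                                         ∎
    where
    open ≡-Reasoning
    take-∷ʳ : ∀ w x → length w ≡ n → take n (w ∷ʳ x) ≡ w
    take-∷ʳ w x refl = take-length-++ w (x ∷ [])

  countWords-take-drop : ∀ a b P Q →
    countWords (a + b) (λ w → P (take a w) ∧ Q (drop a w)) ≡ countWords a P * countWords b Q
  countWords-take-drop zero    b P Q with P []
  ... | true  = sym (+-identityʳ (countWords b Q))
  ... | false = count-false (allWords k b)
  countWords-take-drop (suc a) b P Q = begin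
    countWords (suc a + b) (λ w → P (take (suc a) w) ∧ Q (drop (suc a) w))
      ≡⟨ countWords-suc (a + b) _ ⟩
    ∑[ i < k ] countWords (a + b) (λ w → P (letter i ∷ take a w) ∧ Q (drop a w))
      ≡⟨ sum-cong-≗ {k} (λ i → countWords-take-drop a b (λ u → P (letter i ∷ u)) Q) ⟩
    ∑[ i < k ] (countWords a (λ u → P (letter i ∷ u)) * countWords b Q)
      ≡⟨ *-distribʳ-sum (countWords b Q) (λ i → countWords a (λ u → P (letter i ∷ u))) ⟨
    (∑[ i < k ] countWords a (λ u → P (letter i ∷ u))) * countWords b Q
      ≡⟨ cong (_* countWords b Q) (countWords-suc a P) ⟨
    countWords (suc a) P * countWords b Q
      ∎
    where open ≡-Reasoning

  countWords-reverse : ∀ n P → countWords n (P ∘ reverse) ≡ countWords n P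
  countWords-reverse zero    P = count-congᴬ {P = P ∘ reverse} {Q = P} (refl ∷ [])
  countWords-reverse (suc n) P = begin
    countWords (suc n) (P ∘ reverse)                           ≡⟨ countWords-suc n (P ∘ reverse) ⟩
    ∑[ i < k ] countWords n (λ w → P (reverse (letter i ∷ w)))
      ≡⟨ sum-cong-≗ {k} (λ i → trans (count-cong (λ w → cong P (unfold-reverse (letter i) w)) (allWords k n))
                                     (countWords-reverse n (λ w → P (w ∷ʳ letter i)))) ⟩
    ∑[ i < k ] countWords n (λ w → P (w ∷ʳ letter i))          ≡⟨ countWords-snoc n P ⟨
    countWords (suc n) P                                       ∎
    where open ≡-Reasoning

  complement-letter : ∀ i → suc k ∸ letter i ≡ letter (opposite i)
  complement-letter i = trans (+-∸-assoc 1 (toℕ<n i)) (cong suc (sym (opposite-prop i)))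

  countWords-complement : ∀ n P → countWords n (λ w → P (map (suc k ∸_) w)) ≡ countWords n P
  countWords-complement zero    P = count-congᴬ {P = λ w → P (map (suc k ∸_) w)} {Q = P} (refl ∷ [])
  countWords-complement (suc n) P = begin
    countWords (suc n) (λ w → P (map (suc k ∸_) w))                           ≡⟨ countWords-suc n _ ⟩
    ∑[ i < k ] countWords n (λ w → P ((suc k ∸ letter i) ∷ map (suc k ∸_) w))
      ≡⟨ sum-cong-≗ {k} (λ i → countWords-complement n (λ w → P ((suc k ∸ letter i) ∷ w))) ⟩
    ∑[ i < k ] countWords n (λ w → P ((suc k ∸ letter i) ∷ w))
      ≡⟨ sum-cong-≗ {k} (λ i → cong (λ a → countWords n (λ w → P (a ∷ w))) (complement-letter i)) ⟩
    ∑[ i < k ] countWords n (λ w → P (letter (opposite i) ∷ w))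
      ≡⟨ sum-permute (λ i → countWords n (λ w → P (letter i ∷ w))) Perm.reverse ⟨
    ∑[ i < k ] countWords n (λ w → P (letter i ∷ w))                          ≡⟨ countWords-suc n P ⟨
    countWords (suc n) P                                                      ∎
    where open ≡-Reasoning

  minimalCount : List ℕ → ℕ → ℕ
  minimalCount p j = countWords j (λ u → becomesTrueAt (occursInPrefix p u) j)

  minimalCount-zero : ∀ p → minimalCount p 0 + avoidCount k 0 (p ∷ []) ≡ 1
  minimalCount-zero p = sym (trans (count-split (λ _ → true) (occurs p) (allWords k 0))
    (cong (_+ avoidCount k 0 (p ∷ [])) (count-congᴬ {P = occurs p} {Q = λ _ → occurs p []} (refl ∷ []))))

  minimalCount-suc : ∀ p j →
    minimalCount p (suc j) + avoidCount k (suc j) (p ∷ []) ≡ k * avoidCount k j (p ∷ [])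
  minimalCount-suc p j = begin
    minimalCount p (suc j) + avoidCount k (suc j) (p ∷ [])
      ≡⟨ cong₂ _+_ (count-cong (λ u → ∧-comm (occurs p (take (suc j) u)) _) (allWords k (suc j)))
                   (countWords-congᵂ (suc j) (λ u |u| _ → sym (avoidsPrefixes u |u|))) ⟩
    countWords (suc j) (λ u → not (occurs p (take j u)) ∧ occurs p (take (suc j) u))
      + countWords (suc j) (λ u → not (occurs p (take j u)) ∧ not (occurs p (take (suc j) u)))
      ≡⟨ count-split (λ u → not (occurs p (take j u))) (λ u → occurs p (take (suc j) u)) (allWords k (suc j)) ⟨
    countWords (suc j) (λ u → not (occurs p (take j u)))
      ≡⟨ countWords-take j (λ u → not (occurs p u)) ⟩
    k * avoidCount k j (p ∷ []) ∎
    where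
    open ≡-Reasoning
    avoidsPrefixes : ∀ u → length u ≡ suc j →
      not (occurs p (take j u)) ∧ not (occurs p (take (suc j) u)) ≡ not (occurs p u)
    avoidsPrefixes u |u| = trans (not-∧-absorb (occursInPrefix-increasing p u j))
                                 (cong (not ∘ occurs p) (take-all (suc j) u (≤-reflexive |u|)))

  minimalCount-cong : ∀ {p p′} → (∀ n → avoidCount k n (p ∷ []) ≡ avoidCount k n (p′ ∷ [])) →
    ∀ j → minimalCount p j ≡ minimalCount p′ j
  minimalCount-cong {p} {p′} p≈p′ j =
    +-cancelʳ-≡ (avoidCount k j (p′ ∷ [])) _ _ (trans (cong (minimalCount p j +_) (sym (p≈p′ j))) (sameTotal j))
    where
    sameTotal : ∀ j → minimalCount p j + avoidCount k j (p ∷ []) ≡ minimalCount p′ j + avoidCount k j (p′ ∷ [])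
    sameTotal zero    = trans (minimalCount-zero p) (sym (minimalCount-zero p′))
    sameTotal (suc j) = trans (minimalCount-suc p j) (trans (cong (k *_) (p≈p′ j)) (sym (minimalCount-suc p′ j)))

  countWords-firstOccurrence : ∀ p ps {n} j → j ≤ n →
    countWords n (λ w → avoids (p ∷ ps) w ∧ becomesTrueAt (occursInPrefix p w) j)
      ≡ minimalCount p j * avoidCount k (n ∸ j) ps
  countWords-firstOccurrence p ps {n} j j≤n = begin
    countWords n (λ w → avoids (p ∷ ps) w ∧ becomesTrueAt (occursInPrefix p w) j)
      ≡⟨ count-cong cutAtFirst (allWords k n) ⟩
    countWords n (λ w → becomesTrueAt (occursInPrefix p (take j w)) j ∧ avoids ps (drop j w))
      ≡⟨ cong (λ m → countWords m _) (m+[n∸m]≡n j≤n) ⟨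
    countWords (j + (n ∸ j)) (λ w → becomesTrueAt (occursInPrefix p (take j w)) j ∧ avoids ps (drop j w))
      ≡⟨ countWords-take-drop j (n ∸ j) _ (avoids ps) ⟩
    minimalCount p j * avoidCount k (n ∸ j) ps ∎
    where
    open ≡-Reasoning
    cutAtFirst : ∀ w → avoids (p ∷ ps) w ∧ becomesTrueAt (occursInPrefix p w) j
                     ≡ becomesTrueAt (occursInPrefix p (take j w)) j ∧ avoids ps (drop j w)
    cutAtFirst w rewrite becomesTrueAt-take p w j with becomesTrueAt (occursInPrefix p w) j in first
    ... | true  = trans (∧-identityʳ _) (cong not (containsM-becomesTrueAt p ps w j first))
    ... | false = ∧-zeroʳ _

  countWords-neverOccurs : ∀ p ps n →
    countWords n (λ w → avoids (p ∷ ps) w ∧ not (occursInPrefix p w n)) ≡ avoidCount k n (p ∷ [])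
  countWords-neverOccurs p ps n = countWords-congᵂ n λ w |w| _ →
    trans (cong (λ v → avoids (p ∷ ps) w ∧ not (occurs p v)) (take-all n w (≤-reflexive |w|)))
          (not-∧-absorb (containsM⇒occurs p ps w))

  avoidCount-∷ : ∀ p ps n → avoidCount k n (p ∷ ps)
    ≡ avoidCount k n (p ∷ []) + ∑[ j < suc n ] (minimalCount p (toℕ j) * avoidCount k (n ∸ toℕ j) ps)
  avoidCount-∷ p ps n = begin
    avoidCount k n (p ∷ ps)
      ≡⟨ count-partition (occursInPrefix p) (occursInPrefix-increasing p) (avoids (p ∷ ps)) n (allWords k n) ⟩
    ∑[ j < suc n ] countWords n (λ w → avoids (p ∷ ps) w ∧ becomesTrueAt (occursInPrefix p w) (toℕ j))
      + countWords n (λ w → avoids (p ∷ ps) w ∧ not (occursInPrefix p w n))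
      ≡⟨ cong₂ _+_ (sum-cong-≗ {suc n} (λ j → countWords-firstOccurrence p ps (toℕ j) (≤-pred (toℕ<n j))))
                   (countWords-neverOccurs p ps n) ⟩
    ∑[ j < suc n ] (minimalCount p (toℕ j) * avoidCount k (n ∸ toℕ j) ps) + avoidCount k n (p ∷ [])
      ≡⟨ +-comm (∑[ j < suc n ] (minimalCount p (toℕ j) * avoidCount k (n ∸ toℕ j) ps)) _ ⟩
    avoidCount k n (p ∷ []) + ∑[ j < suc n ] (minimalCount p (toℕ j) * avoidCount k (n ∸ toℕ j) ps) ∎
    where open ≡-Reasoning

open Words using (countWords-congᵂ; countWords-reverse; countWords-complement; minimalCount; minimalCount-cong; avoidCount-∷)

≡ₚ-blockwise : ∀ {ps ps′} → Pointwise (λ p p′ → (p ∷ []) ≡ₚ (p′ ∷ [])) ps ps′ → ps ≡ₚ ps′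
≡ₚ-blockwise []                                           k n = refl
≡ₚ-blockwise {p ∷ ps} {p′ ∷ ps′} (p≈p′ ∷ ps≈ps′) k n = begin
  avoidCount k n (p ∷ ps)
    ≡⟨ avoidCount-∷ k p ps n ⟩
  avoidCount k n (p ∷ []) + ∑[ j < suc n ] (minimalCount k p (toℕ j) * avoidCount k (n ∸ toℕ j) ps)
    ≡⟨ cong₂ _+_ (p≈p′ k n) (sum-cong-≗ {suc n} (λ j →
         cong₂ _*_ (minimalCount-cong k (p≈p′ k) (toℕ j)) (≡ₚ-blockwise ps≈ps′ k (n ∸ toℕ j)))) ⟩
  avoidCount k n (p′ ∷ []) + ∑[ j < suc n ] (minimalCount k p′ (toℕ j) * avoidCount k (n ∸ toℕ j) ps′)
    ≡⟨ avoidCount-∷ k p′ ps′ n ⟨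
  avoidCount k n (p′ ∷ ps′) ∎
  where open ≡-Reasoning

reverse-≡ₚ : ∀ p → (reverse p ∷ []) ≡ₚ (p ∷ [])
reverse-≡ₚ p k n =
  trans (sym (countWords-reverse k n (λ w → not (occurs (reverse p) w))))
        (count-cong (λ w → cong not (occurs-reverse-≡ p w)) (allWords k n))

complement-≡ₚ : ∀ p → (complement p ∷ []) ≡ₚ (p ∷ [])
complement-≡ₚ p k n =
  trans (sym (countWords-complement k n (λ w → not (occurs (complement p) w))))
        (countWords-congᵂ k n (λ w _ w≤k →
          cong not (occurs-complement (maxLetter p) k p w (All-≤-maxLetter p) w≤k)))

applyTB-≡ₚ : ∀ f p → (p ∷ []) ≡ₚ (applyTB f p ∷ [])
applyTB-≡ₚ R  p k n = sym (reverse-≡ₚ p k n)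
applyTB-≡ₚ C  p k n = sym (complement-≡ₚ p k n)
applyTB-≡ₚ RC p k n = sym (trans (reverse-≡ₚ (complement p) k n) (complement-≡ₚ p k n))

mainTheorem6 : (m₀ m₁ : ℕ) (τ⁰ τ¹ : List ℕ) → IsPattern m₀ τ⁰ → IsPattern m₁ τ¹ →
    (f₁ f₂ : TrivialBijection) →
    (τ⁰ ∷ τ¹ ∷ []) ≡ₚ (applyTB f₁ τ⁰ ∷ applyTB f₂ τ¹ ∷ [])
mainTheorem6 _ _ τ⁰ τ¹ _ _ f₁ f₂ = ≡ₚ-blockwise (applyTB-≡ₚ f₁ τ⁰ ∷ applyTB-≡ₚ f₂ τ¹ ∷ [])
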